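{- Let $\mathbf r$ be the rank array of a Zelevinsky permutation with block sizes $r_0,\ldots,r_n$, and consider block sizes $1+r_0,\ldots,1+r_n$. Suppose $P_1,\ldots,P_n$ are pipe dreams, $P_j$ of size $(1+r_{j-1})\times(1+r_j)$, such that $P(P_1,\ldots,P_n)\in\mathcal P(v(1+\mathbf r))$ and each $\check P_j$ is the top pipe dream of some $(1+r_{j-1})\times(1+r_j)$ partial permutation $w_j$. Then all crosses of each $P_j$ lie in the southwest $r_{j-1}\times r_j$ rectangle of $P_j$ (equivalently, of the superantidiagonal block in block row $j-1$ in which $P_j$ sits); i.e. the top row and rightmost column of $P_j$ contain no crosses.
   Context: Zelevinsky permutations: for block sizes $s_0,\ldots,s_n$, $N=\sum s_j$, block row $j$ (from top) of an $N\times N$ matrix has height $s_j$, block column $i$ (from the right) has width $s_i$, $B_{ji}$ the corresponding block. A Zelevinsky permutation is an $N\times N$ permutation matrix with $B_{ji}=0$ for $i\ge j+2$ and $1$'s proceeding northwest to southeast in every block row and block column; its rank array ($r_{ij}$, $i\ge j$, the number of $1$'s in blocks $B_{qp}$ with $q\ge j,p\le i$) determines it: $v(\mathbf r)$. $1+\mathbf r$ adds $1$ to every entry and block size, and is the rank array of a Zelevinsky permutation $v(1+\mathbf r)$ with block sizes $1+r_j$. Partial permutations: $0/1$ matrices with at most one $1$ per row and column; $\tilde w$ is the minimal-length completion to a permutation. Pipe dreams: finite sets of boxes (crosses) in a grid, the rest elbows; the word lists $s_{i+j-1}$ for each cross at row $i$, column $j$, rows read right to left, top to bottom; $\delta(P)$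 is the product of the word using $s_i^2=s_i$ and braid relations; $\mathcal P(v)=\{P:\delta(P)=v\}$; $P$ is reduced if no two pipes cross twice; the top pipe dream of $w$ is the unique reduced pipe dream $D$ with $\delta(D)=\tilde w$ having no elbow tile directly north of a crossing tile. $\check P$ is $P$ rotated by $180^\circ$. For pipe dreams $P_j$ of size $s_{j-1}\times s_j$, $P(P_1,\ldots,P_n)$ is the $N\times N$ pipe dream whose crosses are all boxes of blocks $B_{ji}$ with $i\ge j+2$ together with $P_j$ placed in block $B_{j-1,j}$ (the superantidiagonal block in block row $j-1$). -}

module Defs where

open import Data.Nat using (ℕ; zero; suc; _+_; _∸_; _≤_; _<_; _<ᵇ_; _≤ᵇ_; _≡ᵇ_)
open import Data.Bool using (Bool; true; false; if_then_else_; _∧_)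
open import Data.List using (List; []; _∷_; _++_; foldl)
open import Data.Product using (_×_; Σ)
open import Data.Unit using (⊤)
open import Relation.Binary.PropositionalEquality using (_≡_)

-- Conventions: everything is 0-indexed.  Block sizes are a function
-- s : ℕ → ℕ of which only s 0 , … , s n are used.  Permutations of
-- {0,…,M-1} are functions ℕ → ℕ that are the identity from M on; the
-- permutation matrix of v has its 1 in row x at column v x.

prefix : (ℕ → ℕ) → ℕ → ℕ
prefix s zero    = 0
prefix s (suc j) = prefix s j + s j

total : ℕ → (ℕ → ℕ) → ℕ
total n s = prefix s (suc n)

rowBlk : ℕ → (ℕ → ℕ) → ℕ → ℕ
rowBlk zero    s x = 0
rowBlk (suc n) s x =
  if x <ᵇ s 0 then 0 else suc (rowBlk n (λ k → s (suc k)) (x ∸ s 0))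

-- index of the block column (counted from the right) containing column y
colBlk : ℕ → (ℕ → ℕ) → ℕ → ℕ
colBlk n s y = rowBlk n s (total n s ∸ suc y)

colStart : ℕ → (ℕ → ℕ) → ℕ → ℕ
colStart n s i = total n s ∸ prefix s (suc i)

IsPerm : ℕ → (ℕ → ℕ) → Set
IsPerm M v =
  (∀ x → x < M → v x < M) ×
  (∀ x y → x < M → y < M → v x ≡ v y → x ≡ y) ×
  (∀ x → M ≤ x → v x ≡ x)

Zelevinsky : ℕ → (ℕ → ℕ) → (ℕ → ℕ) → Set
Zelevinsky n s v =
  IsPerm (total n s) v ×
  (∀ x → x < total n s → colBlk n s (v x) < rowBlk n s x + 2) ×
  (∀ x y → x < y → y < total n s →
     rowBlk n s x ≡ rowBlk n s y → v x < v y) ×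
  (∀ x y → x < y → y < total n s →
     colBlk n s (v x) ≡ colBlk n s (v y) → v x < v y)

count : ℕ → (ℕ → Bool) → ℕ
count zero    p = 0
count (suc M) p = if p M then suc (count M p) else count M p

-- rank array entry: number of 1's of v in blocks B_{qp} with q ≥ j, p ≤ i
-- (used for i ≤ j)
rank : ℕ → (ℕ → ℕ) → (ℕ → ℕ) → ℕ → ℕ → ℕ
rank n s v i j =
  count (total n s) (λ x → (j ≤ᵇ rowBlk n s x) ∧ (colBlk n s (v x) ≤ᵇ i))

-- Pipe dreams: P i j = true means a cross in row i, column j (0-indexed).

PipeDream : Set
PipeDream = ℕ → ℕ → Bool

Fits : ℕ → ℕ → PipeDream → Set
Fits a b P = ∀ i j → P i j ≡ true → (i < a) × (j < b)

-- the word of row i, columns b-1 down to 0 (right to left);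
-- a cross at (i , j) contributes the letter i + j, i.e. the simple
-- transposition swapping i + j and i + j + 1 (this is s_{i+j-1} 1-indexed)
rowWord : ℕ → PipeDream → ℕ → List ℕ
rowWord zero    P i = []
rowWord (suc j) P i = if P i j then (i + j) ∷ rowWord j P i else rowWord j P i

word : ℕ → ℕ → PipeDream → List ℕ
word zero    b P = []
word (suc a) b P = word a b P ++ rowWord b P a

swap : ℕ → ℕ → ℕ
swap a x = if x ≡ᵇ a then suc a else (if x ≡ᵇ suc a then a else x)

-- Demazure product w ⋆ s_a : w s_a if this is longer, else w
demStep : (ℕ → ℕ) → ℕ → (ℕ → ℕ)
demStep w a = if w a <ᵇ w (suc a) then (λ x → w (swap a x)) else w

demazure : List ℕ → (ℕ → ℕ)
demazure = foldl demStep (λ x → x)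

δ : ℕ → ℕ → PipeDream → (ℕ → ℕ)
δ a b P = demazure (word a b P)

InPD : ℕ → ℕ → PipeDream → (ℕ → ℕ) → Set
InPD a b P v = ∀ k → δ a b P k ≡ v k

-- the word is reduced (every Demazure step is a length-increasing step)
ReducedFrom : (ℕ → ℕ) → List ℕ → Set
ReducedFrom w []       = ⊤
ReducedFrom w (a ∷ as) = (w a < w (suc a)) × ReducedFrom (λ x → w (swap a x)) as

Reduced : ℕ → ℕ → PipeDream → Set
Reduced a b P = ReducedFrom (λ x → x) (word a b P)

rot : ℕ → ℕ → PipeDream → PipeDream
rot a b P i j = if (i <ᵇ a) ∧ (j <ᵇ b) then P (a ∸ suc i) (b ∸ suc j) else false

PartialPerm : ℕ → ℕ → (ℕ → ℕ → Bool) → Set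
PartialPerm a b W =
  Fits a b W ×
  (∀ i j k → W i j ≡ true → W i k ≡ true → j ≡ k) ×
  (∀ i k j → W i j ≡ true → W k j ≡ true → i ≡ k)

Completion : ℕ → ℕ → (ℕ → ℕ → Bool) → (ℕ → ℕ) → Set
Completion a b W u =
  ∀ i j → i < a → j < b → (W i j ≡ true → u i ≡ j) × (u i ≡ j → W i j ≡ true)

-- number of inversions (= Coxeter length) of a permutation of {0,…,M-1}
inversions : ℕ → (ℕ → ℕ) → ℕ
inversions zero    u = 0
inversions (suc M) u = inversions M u + count M (λ x → u M <ᵇ u x)

IsMinCompletion : ℕ → ℕ → (ℕ → ℕ → Bool) → (ℕ → ℕ) → Set
IsMinCompletion a b W u =
  Σ ℕ (λ M → IsPerm M u × Completion a b W u ×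
    (∀ M' u' → IsPerm M' u' → Completion a b W u' →
       inversions M u ≤ inversions M' u'))

IsTopPipeDream : ℕ → ℕ → PipeDream → (ℕ → ℕ → Bool) → Set
IsTopPipeDream a b D W =
  Fits a b D × Reduced a b D ×
  Σ (ℕ → ℕ) (λ u → IsMinCompletion a b W u × (∀ k → δ a b D k ≡ u k)) ×
  (∀ i j → D (suc i) j ≡ true → D i j ≡ true)

-- P(P_1,…,P_n) for block sizes s : crosses in all blocks B_{ji} with
-- i ≥ j+2, and P_i placed in block B_{i-1,i} (local coordinates).

bigPD : ℕ → (ℕ → ℕ) → (ℕ → PipeDream) → PipeDream
bigPD n s Ps x y =
  if (x <ᵇ total n s) ∧ (y <ᵇ total n s)
  then (if rowBlk n s x + 2 ≤ᵇ colBlk n s y then true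
        else (if colBlk n s y ≡ᵇ suc (rowBlk n s x)
              then Ps (colBlk n s y) (x ∸ prefix s (rowBlk n s x))
                                     (y ∸ colStart n s (colBlk n s y))
              else false))
  else false

plus1 : (ℕ → ℕ) → (ℕ → ℕ)
plus1 s k = suc (s k)

{-# OPTIONS --safe #-}

-- A Demazure step at ℓ swaps the values at ℓ and ℓ + 1 only if the smaller one is at ℓ, and
-- afterwards position ℓ + 1 holds at most the old value at ℓ.  So "some position ≥ p carries a
-- value ≤ c" survives every step, and the letter c, contributed by a cross of P(P₁,…,Pₙ) on
-- antidiagonal c, pushes such a value past c: δ sends some position > c to a value ≤ c.  The
-- south-east corner of Pⱼ lies on antidiagonal N − 2, whereas v(1 + r) fixes N − 1: its
-- bottom-right block contains a 1 (r′₀ₙ = 1 + r₀ₙ > 0) and 1's proceed north-west to south-east.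
-- Hence that corner is an elbow, i.e. Ďⱼ has no cross at (0, 0).  In a top pipe dream crosses
-- propagate north, and a cross in the bottom row forces one in the bottom-left corner; so a cross
-- of Pⱼ in its top row or rightmost column, i.e. of Ďⱼ in its bottom row or leftmost column, would
-- put a cross at (0, 0).
module Submission where

open import Defs
open import Data.Bool using (Bool; true; false; T; if_then_else_)
open import Data.Bool.Properties using (T-≡; T-∧)
open import Data.List using ([]; _∷_; foldl)
open import Data.List.Properties using (foldl-++)
open import Data.List.Membership.Propositional using (_∈_)
open import Data.List.Membership.Propositional.Properties using (∈-++⁺ˡ; ∈-++⁺ʳ)
open import Data.List.Relation.Unary.Any using (here; there)
open import Data.Nat
open import Data.Nat.Properties
open import Data.Nat.Tactic.RingSolver using (solve-∀)
open import Data.Product using (_×_; Σ; ∃; ∃₂; _,_; proj₁; proj₂)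
open import Data.Sum using (inj₁; inj₂; _⊎_)
open import Data.Unit using (tt)
open import Function using (_∘_)
open import Function.Bundles using (Equivalence)
open import Function.Definitions using (StrictlySurjective)
open import Relation.Binary.PropositionalEquality
open import Relation.Nullary using (¬_; yes; no; contradiction)
open import Relation.Nullary.Reflects using (ofʸ; ofⁿ)

T⇒≡true : ∀ {b} → T b → b ≡ true
T⇒≡true = Equivalence.to T-≡

¬T⇒≡false : ∀ {b} → ¬ T b → b ≡ false
¬T⇒≡false {false} _  = refl
¬T⇒≡false {true}  ¬t = contradiction tt ¬t

module _ {A B : Set} (f : A → B → A) where

  foldl-preserves : ∀ {P : A → Set} → (∀ a y → P a → P (f a y)) → ∀ ys {a} → P a → P (foldl f a ys)
  foldl-preserves pres []       pa = pa
  foldl-preserves pres (y ∷ ys) pa = foldl-preserves pres ys (pres _ y pa)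

  foldl-∈ : ∀ {P Q : A → Set} {y} → (∀ a z → P a → P (f a z)) → (∀ a z → Q a → Q (f a z)) →
            (∀ a → P a → Q (f a y)) → ∀ {ys a} → y ∈ ys → P a → Q (foldl f a ys)
  foldl-∈ presP presQ hit {_ ∷ ys} (here refl) pa = foldl-preserves presQ ys (hit _ pa)
  foldl-∈ presP presQ hit (there y∈ys) pa = foldl-∈ presP presQ hit y∈ys (presP _ _ pa)

-- Demazure products of words

swap-self : ∀ a → swap a a ≡ suc a
swap-self a rewrite T⇒≡true (≡⇒≡ᵇ a a refl) = refl

swap-suc : ∀ a → swap a (suc a) ≡ a
swap-suc a rewrite ¬T⇒≡false (1+n≢n ∘ ≡ᵇ⇒≡ (suc a) a) | T⇒≡true (≡⇒≡ᵇ a a refl) = refl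

swap-other : ∀ {a x} → x ≢ a → x ≢ suc a → swap a x ≡ x
swap-other {a} {x} x≢a x≢1+a
  rewrite ¬T⇒≡false (x≢a ∘ ≡ᵇ⇒≡ x a) | ¬T⇒≡false (x≢1+a ∘ ≡ᵇ⇒≡ x (suc a)) = refl

swap-below : ∀ {a x} → x < a → swap a x ≡ x
swap-below x<a = swap-other (<⇒≢ x<a) (<⇒≢ (m<n⇒m<1+n x<a))

swap-above : ∀ {a x} → suc a < x → swap a x ≡ x
swap-above 1+a<x = swap-other (>⇒≢ (<-trans (n<1+n _) 1+a<x)) (>⇒≢ 1+a<x)

swap-involutive : ∀ a x → swap a (swap a x) ≡ x
swap-involutive a x with x ≟ a | x ≟ suc a
... | yes refl | _        = trans (cong (swap a) (swap-self a)) (swap-suc a)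
... | no _     | yes refl = trans (cong (swap a) (swap-suc a)) (swap-self a)
... | no x≢a   | no x≢1+a = trans (cong (swap a) (swap-other x≢a x≢1+a)) (swap-other x≢a x≢1+a)

swap-injective : ∀ a {x y} → swap a x ≡ swap a y → x ≡ y
swap-injective a {x} {y} e =
  trans (sym (swap-involutive a x)) (trans (cong (swap a) e) (swap-involutive a y))

swap-< : ∀ {a M} x → suc a < M → x < M → swap a x < M
swap-< {a} x 1+a<M x<M with x ≟ a | x ≟ suc a
... | yes refl | _        = subst (_< _) (sym (swap-self a)) 1+a<M
... | no _     | yes refl = subst (_< _) (sym (swap-suc a)) (<-trans (n<1+n a) 1+a<M)
... | no x≢a   | no x≢1+a = subst (_< _) (sym (swap-other x≢a x≢1+a)) x<M

data DemStepCase (w : ℕ → ℕ) (a : ℕ) : (ℕ → ℕ) → Set where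
  ascent     : w a < w (suc a) → DemStepCase w a (w ∘ swap a)
  non-ascent : w (suc a) ≤ w a → DemStepCase w a w

demStep-cases : ∀ w a → DemStepCase w a (demStep w a)
demStep-cases w a with w a <ᵇ w (suc a) | <ᵇ-reflects-< (w a) (w (suc a))
... | true  | ofʸ lt  = ascent lt
... | false | ofⁿ ¬lt = non-ascent (≮⇒≥ ¬lt)

demStep-moves-right : ∀ w ℓ x → ∃ λ x′ → x ≤ x′ × (x ≡ ℓ → ℓ < x′) × demStep w ℓ x′ ≤ w x
demStep-moves-right w ℓ x with demStep w ℓ | demStep-cases w ℓ | x ≟ ℓ
... | _ | ascent _      | yes refl = suc x , n≤1+n x , (λ _ → ≤-refl) , ≤-reflexive (cong w (swap-suc x))
... | _ | non-ascent le | yes refl = suc x , n≤1+n x , (λ _ → ≤-refl) , le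
... | _ | non-ascent _  | no x≢ℓ   = x , ≤-refl , (λ x≡ℓ → contradiction x≡ℓ x≢ℓ) , ≤-refl
... | _ | ascent lt     | no x≢ℓ with x ≟ suc ℓ
...   | yes refl =
  x , ≤-refl , (λ x≡ℓ → contradiction x≡ℓ x≢ℓ) , ≤-trans (≤-reflexive (cong w (swap-suc ℓ))) (<⇒≤ lt)
...   | no x≢1+ℓ =
  x , ≤-refl , (λ x≡ℓ → contradiction x≡ℓ x≢ℓ) , ≤-reflexive (cong w (swap-other x≢ℓ x≢1+ℓ))

demStep-moves-zero : ∀ w ℓ {x} → w x ≡ 0 →
  ∃ λ x′ → demStep w ℓ x′ ≡ 0 × (x′ ≡ x ⊎ (x ≡ ℓ × x′ ≡ suc ℓ))
demStep-moves-zero w ℓ {x} wx≡0 with demStep w ℓ | demStep-cases w ℓ | x ≟ ℓ | x ≟ suc ℓ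
... | _ | non-ascent _ | _        | _        = x , wx≡0 , inj₁ refl
... | _ | ascent _     | yes refl | _        =
  suc x , trans (cong w (swap-suc x)) wx≡0 , inj₂ (refl , refl)
... | _ | ascent lt    | no _     | yes refl = contradiction (subst (w ℓ <_) wx≡0 lt) n≮0
... | _ | ascent _     | no x≢ℓ   | no x≢1+ℓ =
  x , trans (cong w (swap-other x≢ℓ x≢1+ℓ)) wx≡0 , inj₁ refl

demStep-surjective : ∀ w ℓ → StrictlySurjective _≡_ w → StrictlySurjective _≡_ (demStep w ℓ)
demStep-surjective w ℓ surj y with demStep w ℓ | demStep-cases w ℓ | surj y
... | _ | non-ascent _ | x , wx≡y = x , wx≡y
... | _ | ascent _     | x , wx≡y = swap ℓ x , trans (cong w (swap-involutive ℓ x)) wx≡y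

rowWord-∈ : ∀ {P i j} b → P i j ≡ true → j < b → i + j ∈ rowWord b P i
rowWord-∈ {P} {i} {j} (suc b) pij j<1+b with j ≟ b
... | yes refl rewrite pij = here refl
... | no j≢b with P i b
...   | true  = there (rowWord-∈ b pij (≤∧≢⇒< (≤-pred j<1+b) j≢b))
...   | false = rowWord-∈ b pij (≤∧≢⇒< (≤-pred j<1+b) j≢b)

word-∈ : ∀ {P i j} a b → P i j ≡ true → i < a → j < b → i + j ∈ word a b P
word-∈ {P} {i} (suc a) b pij i<1+a j<b with i ≟ a
... | yes refl = ∈-++⁺ʳ (word i b P) (rowWord-∈ b pij j<b)
... | no i≢a   = ∈-++⁺ˡ (word-∈ a b pij (≤∧≢⇒< (≤-pred i<1+a) i≢a) j<b)

δ-suc : ∀ a b P → δ (suc a) b P ≡ foldl demStep (δ a b P) (rowWord b P a)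
δ-suc a b P = foldl-++ demStep (λ x → x) (word a b P) (rowWord b P a)

δ-surjective : ∀ a b P → StrictlySurjective _≡_ (δ a b P)
δ-surjective a b P =
  foldl-preserves demStep {P = StrictlySurjective _≡_} demStep-surjective (word a b P) (λ y → y , refl)

Displaced : ℕ → ℕ → (ℕ → ℕ) → Set
Displaced c t w = ∃ λ x → t + c ≤ x × w x ≤ c

displaced-demStep : ∀ {c t} w ℓ → Displaced c t w → Displaced c t (demStep w ℓ)
displaced-demStep w ℓ (x , t+c≤x , wx≤c) with demStep-moves-right w ℓ x
... | x′ , x≤x′ , _ , w′x′≤wx = x′ , ≤-trans t+c≤x x≤x′ , ≤-trans w′x′≤wx wx≤c

displaced-push : ∀ {c t} w → Displaced c t w → Displaced c (suc t) (demStep w (t + c))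
displaced-push {c} {t} w (x , t+c≤x , wx≤c) with demStep-moves-right w (t + c) x | x ≟ t + c
... | x′ , _    , pushed , w′x′≤wx | yes x≡t+c = x′ , pushed x≡t+c , ≤-trans w′x′≤wx wx≤c
... | x′ , x≤x′ , _      , w′x′≤wx | no x≢t+c  =
  x′ , <-≤-trans (≤∧≢⇒< t+c≤x (x≢t+c ∘ sym)) x≤x′ , ≤-trans w′x′≤wx wx≤c

δ-column-displaced : ∀ {b c} D → c < b → ∀ t → (∀ i → i < t → D i c ≡ true) → Displaced c t (δ t b D)
δ-column-displaced {b} {c} D c<b zero    _    = c , ≤-refl , ≤-refl
δ-column-displaced {b} {c} D c<b (suc t) full =
  subst (Displaced c (suc t)) (sym (δ-suc t b D))
    (foldl-∈ demStep displaced-demStep displaced-demStep displaced-push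
       (rowWord-∈ b (full t ≤-refl) c<b)
       (δ-column-displaced D c<b t (λ i i<t → full i (m<n⇒m<1+n i<t))))

δ-cross-displaced : ∀ {a b x y} P → P x y ≡ true → x < a → y < b → Displaced (x + y) 1 (δ a b P)
δ-cross-displaced {a} {b} {x} {y} P pxy x<a y<b =
  foldl-∈ demStep (displaced-demStep {t = 0}) (displaced-demStep {t = 1}) (displaced-push {t = 0})
    (word-∈ a b pxy x<a y<b) (x + y , ≤-refl , ≤-refl)

δ-fixing⇒cross-below : ∀ {a b x y} m P → (∀ p → m ≤ p → δ a b P p ≡ p) →
  P x y ≡ true → x < a → y < b → suc (x + y) < m
δ-fixing⇒cross-below m P fixes pxy x<a y<b with δ-cross-displaced P pxy x<a y<b
... | p , x+y<p , δp≤x+y with m ≤? p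
...   | yes m≤p = contradiction (subst (_≤ _) (fixes p m≤p) δp≤x+y) (<⇒≱ x+y<p)
...   | no  m≰p = ≤-<-trans x+y<p (≰⇒> m≰p)

ZeroWithin : ℕ → (ℕ → ℕ) → Set
ZeroWithin t w = ∃ λ x → x ≤ t × w x ≡ 0

zeroWithin-suc : ∀ {t w} → ZeroWithin t w → ZeroWithin (suc t) w
zeroWithin-suc (x , x≤t , wx≡0) = x , m≤n⇒m≤1+n x≤t , wx≡0

zeroWithin-demStep : ∀ {t} w {ℓ} → ℓ ≢ t → ZeroWithin t w → ZeroWithin t (demStep w ℓ)
zeroWithin-demStep w {ℓ} ℓ≢t (x , x≤t , wx≡0) with demStep-moves-zero w ℓ wx≡0
... | x′ , w′x′≡0 , inj₁ refl          = x′ , x≤t , w′x′≡0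
... | x′ , w′x′≡0 , inj₂ (refl , refl) = x′ , ≤∧≢⇒< x≤t ℓ≢t , w′x′≡0

zeroWithin-demStep-suc : ∀ {t} w ℓ → ZeroWithin t w → ZeroWithin (suc t) (demStep w ℓ)
zeroWithin-demStep-suc w ℓ (x , x≤t , wx≡0) with demStep-moves-zero w ℓ wx≡0
... | x′ , w′x′≡0 , inj₁ refl          = x′ , m≤n⇒m≤1+n x≤t , w′x′≡0
... | x′ , w′x′≡0 , inj₂ (refl , refl) = x′ , s≤s x≤t , w′x′≡0

module _ (D : PipeDream) (t : ℕ) where

  rowWord-zeroWithin : D t 0 ≡ false → ∀ j w → ZeroWithin t w →
    ZeroWithin t (foldl demStep w (rowWord j D t))
  rowWord-zeroWithin elbow zero w z = z
  rowWord-zeroWithin elbow (suc j) w z with D t j in cross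
  rowWord-zeroWithin elbow (suc zero)    w z | true  = contradiction (trans (sym cross) elbow) λ ()
  rowWord-zeroWithin elbow (suc (suc j)) w z | true  =
    rowWord-zeroWithin elbow (suc j) _ (zeroWithin-demStep w (m+1+n≢m t) z)
  rowWord-zeroWithin elbow (suc j)       w z | false = rowWord-zeroWithin elbow j w z

  -- The letters of row t are t + j for decreasing j, so the letter t, the only one that can move
  -- the 0 out of positions ≤ t, comes last.
  rowWord-zeroWithin-suc : ∀ j w → ZeroWithin t w → ZeroWithin (suc t) (foldl demStep w (rowWord j D t))
  rowWord-zeroWithin-suc zero w z = zeroWithin-suc z
  rowWord-zeroWithin-suc (suc j) w z with D t j
  rowWord-zeroWithin-suc (suc zero)    w z | true  = zeroWithin-demStep-suc w (t + 0) z
  rowWord-zeroWithin-suc (suc (suc j)) w z | true  =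
    rowWord-zeroWithin-suc (suc j) _ (zeroWithin-demStep w (m+1+n≢m t) z)
  rowWord-zeroWithin-suc (suc j)       w z | false = rowWord-zeroWithin-suc j w z

δ-zeroWithin : ∀ b D t → ZeroWithin t (δ t b D)
δ-zeroWithin b D zero    = 0 , z≤n , refl
δ-zeroWithin b D (suc t) =
  subst (ZeroWithin (suc t)) (sym (δ-suc t b D)) (rowWord-zeroWithin-suc D t b _ (δ-zeroWithin b D t))

-- Minimal completions

count-cong : ∀ m {p q : ℕ → Bool} → (∀ x → x < m → p x ≡ q x) → count m p ≡ count m q
count-cong zero    _   = refl
count-cong (suc m) p≗q rewrite p≗q m ≤-refl | count-cong m (λ x x<m → p≗q x (m<n⇒m<1+n x<m)) = refl

count-witness : ∀ m p → 0 < count m p → ∃ λ x → x < m × T (p x)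
count-witness (suc m) p pos with p m in pm
... | true  = m , ≤-refl , subst T (sym pm) tt
... | false = let x , x<m , px = count-witness m p pos in x , m<n⇒m<1+n x<m , px

count-∘swap : ∀ i m f → suc i < m → count m (f ∘ swap i) ≡ count m f
count-∘swap i (suc m) f 1+i<1+m with m ≟ suc i
... | yes refl rewrite swap-suc i | swap-self i
                     | count-cong i {f ∘ swap i} {f} (λ x x<i → cong f (swap-below x<i))
  with f i | f (suc i)
...   | true  | true  = refl
...   | true  | false = refl
...   | false | true  = refl
...   | false | false = refl
count-∘swap i (suc m) f 1+i<1+m | no m≢1+i =
  cong₂ (λ b c → if b then suc c else c) (cong f (swap-above 1+i<m)) (count-∘swap i m f 1+i<m)
  where
    1+i<m : suc i < m
    1+i<m = ≤∧≢⇒< (≤-pred 1+i<1+m) (m≢1+i ∘ sym)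

inversions-cong : ∀ m {u u′} → (∀ x → x < m → u x ≡ u′ x) → inversions m u ≡ inversions m u′
inversions-cong zero    _    = refl
inversions-cong (suc m) u≗u′ =
  cong₂ _+_ (inversions-cong m (λ x x<m → u≗u′ x (m<n⇒m<1+n x<m)))
            (count-cong m (λ x x<m → cong₂ _<ᵇ_ (u≗u′ m ≤-refl) (u≗u′ x (m<n⇒m<1+n x<m))))

module _ {u : ℕ → ℕ} {i : ℕ} (u[1+i]<u[i] : u (suc i) < u i) where

  private
    above-i : ℕ
    above-i = count i (λ x → u i <ᵇ u x)

    above-1+i : ℕ
    above-1+i = count i (λ x → u (suc i) <ᵇ u x)

    agree-below : ∀ x → x < i → u (swap i x) ≡ u x
    agree-below x x<i = cong u (swap-below x<i)

    swapped-row-i : count i (λ x → u (swap i i) <ᵇ u (swap i x)) ≡ above-1+i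
    swapped-row-i = count-cong i (λ x x<i → cong₂ _<ᵇ_ (cong u (swap-self i)) (agree-below x x<i))

    swapped-row-1+i : count (suc i) (λ x → u (swap i (suc i)) <ᵇ u (swap i x)) ≡ above-i
    swapped-row-1+i rewrite swap-suc i | swap-self i
                          | ¬T⇒≡false (<-asym u[1+i]<u[i] ∘ <ᵇ⇒< (u i) (u (suc i))) =
      count-cong i (λ x x<i → cong (u i <ᵇ_) (agree-below x x<i))

    row-1+i : count (suc i) (λ x → u (suc i) <ᵇ u x) ≡ suc above-1+i
    row-1+i rewrite T⇒≡true (<⇒<ᵇ u[1+i]<u[i]) = refl

    rearrange : ∀ p q r → suc (p + q + r) ≡ p + r + suc q
    rearrange = solve-∀

  -- Only the rows i and i + 1 of the inversion count change: they trade their counts over x < i,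
  -- and the pair (i, i + 1) stops being an inversion.
  inversions-∘swap : ∀ m → suc (suc i) ≤ m → suc (inversions m (u ∘ swap i)) ≡ inversions m u
  inversions-∘swap (suc m) 2+i≤1+m with m ≟ suc i
  ... | yes refl = begin
      suc (inversions (suc (suc i)) (u ∘ swap i))
        ≡⟨ cong suc (cong₂ _+_ (cong₂ _+_ (inversions-cong i agree-below) swapped-row-i)
                               swapped-row-1+i) ⟩
      suc (inversions i u + above-1+i + above-i)
        ≡⟨ rearrange (inversions i u) above-1+i above-i ⟩
      inversions i u + above-i + suc above-1+i
        ≡⟨ cong (inversions i u + above-i +_) (sym row-1+i) ⟩
      inversions (suc (suc i)) u
        ∎
    where open ≡-Reasoning
  ... | no m≢1+i = cong₂ _+_ (inversions-∘swap m 2+i≤m) same-row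
    where
      2+i≤m : suc (suc i) ≤ m
      2+i≤m = ≤∧≢⇒< (≤-pred 2+i≤1+m) (m≢1+i ∘ sym)

      same-row : count m (λ x → u (swap i m) <ᵇ u (swap i x)) ≡ count m (λ x → u m <ᵇ u x)
      same-row rewrite swap-above {i} {m} 2+i≤m = count-∘swap i m (λ x → u m <ᵇ u x) 2+i≤m

perm-injective : ∀ {M u} → IsPerm M u → ∀ {x y} → u x ≡ u y → x ≡ y
perm-injective {M} {u} (bounded , injective , fixed) {x} {y} ux≡uy with x <? M | y <? M
... | yes x<M | yes y<M = injective x y x<M y<M ux≡uy
... | no  x≮M | no  y≮M = trans (sym (fixed x (≮⇒≥ x≮M))) (trans ux≡uy (fixed y (≮⇒≥ y≮M)))
... | yes x<M | no  y≮M =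
  contradiction (subst (_< M) (trans ux≡uy (fixed y (≮⇒≥ y≮M))) (bounded x x<M)) y≮M
... | no  x≮M | yes y<M =
  contradiction (subst (_< M) (trans (sym ux≡uy) (fixed x (≮⇒≥ x≮M))) (bounded y y<M)) x≮M

perm-descent-< : ∀ {M u i} → IsPerm M u → u (suc i) < u i → suc i < M
perm-descent-< {M} {u} {i} (bounded , _ , fixed) u[1+i]<u[i] with suc i <? M
... | yes 1+i<M = 1+i<M
... | no  1+i≮M = contradiction u[i]≤1+i (<⇒≱ (subst (_< u i) (fixed (suc i) M≤1+i) u[1+i]<u[i]))
  where
    M≤1+i : M ≤ suc i
    M≤1+i = ≮⇒≥ 1+i≮M

    u[i]≤1+i : u i ≤ suc i
    u[i]≤1+i with i <? M
    ... | yes i<M = ≤-trans (<⇒≤ (bounded i i<M)) M≤1+i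
    ... | no  i≮M = ≤-trans (≤-reflexive (fixed i (≮⇒≥ i≮M))) (n≤1+n i)

perm-∘swap : ∀ {M u} i → suc i < M → IsPerm M u → IsPerm M (u ∘ swap i)
perm-∘swap {u = u} i 1+i<M (bounded , injective , fixed) =
  (λ x x<M → bounded _ (swap-< x 1+i<M x<M)) ,
  (λ x y x<M y<M e → swap-injective i (injective _ _ (swap-< x 1+i<M x<M) (swap-< y 1+i<M y<M) e)) ,
  (λ x M≤x → trans (cong u (swap-above (<-≤-trans 1+i<M M≤x))) (fixed x M≤x))

perm-fixes-from : ∀ {M v m} → IsPerm M v → M ≡ suc m → v m ≡ m → ∀ p → m ≤ p → v p ≡ p
perm-fixes-from (_ , _ , fixed) M≡1+m vm≡m p m≤p with m≤n⇒m<n∨m≡n m≤p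
... | inj₁ m<p  = fixed p (subst (_≤ p) (sym M≡1+m) m<p)
... | inj₂ refl = vm≡m

completion-∘swap : ∀ {a b W u i} → a ≤ i → Completion a b W u → Completion a b W (u ∘ swap i)
completion-∘swap {i = i} a≤i completion r j r<a j<b
  rewrite swap-below {i} {r} (<-≤-trans r<a a≤i) = completion r j r<a j<b

minCompletion-increasing : ∀ {a b W u} → IsMinCompletion a b W u → ∀ {i} → a ≤ i → u i < u (suc i)
minCompletion-increasing {u = u} (M , perm , completion , minimal) {i} a≤i =
  ≤∧≢⇒< (≮⇒≥ no-descent) (1+n≢n ∘ sym ∘ perm-injective perm)
  where
    no-descent : ¬ (u (suc i) < u i)
    no-descent u[1+i]<u[i] =
      <⇒≱ (≤-reflexive (inversions-∘swap u[1+i]<u[i] M 1+i<M))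
          (minimal M _ (perm-∘swap i 1+i<M perm) (completion-∘swap a≤i completion))
      where
        1+i<M : suc i < M
        1+i<M = perm-descent-< perm u[1+i]<u[i]

increasing⇒+-≤ : ∀ {a} (u : ℕ → ℕ) → (∀ {i} → a ≤ i → u i < u (suc i)) → ∀ d → u a + d ≤ u (a + d)
increasing⇒+-≤ {a} u increasing zero rewrite +-identityʳ a | +-identityʳ (u a) = ≤-refl
increasing⇒+-≤ {a} u increasing (suc d) = begin
  u a + suc d      ≡⟨ +-suc (u a) d ⟩
  suc (u a + d)    ≤⟨ s≤s (increasing⇒+-≤ u increasing d) ⟩
  suc (u (a + d))  ≤⟨ increasing (m≤m+n a d) ⟩
  u (suc (a + d))  ≡⟨ cong u (sym (+-suc a d)) ⟩
  u (a + suc d)    ∎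
  where open ≤-Reasoning

-- Top pipe dreams

NorthClosed : PipeDream → Set
NorthClosed D = ∀ i j → D (suc i) j ≡ true → D i j ≡ true

northClosed-≤ : ∀ {D} → NorthClosed D → ∀ {i t c} → t ≤ i → D i c ≡ true → D t c ≡ true
northClosed-≤ closed {i} {t} t≤i Dic with t ≟ i
... | yes refl = Dic
northClosed-≤ closed {suc i} t≤1+i Dic | no t≢1+i =
  northClosed-≤ closed (≤-pred (≤∧≢⇒< t≤1+i t≢1+i)) (closed i _ Dic)
northClosed-≤ closed {zero} z≤n Dic | no t≢0 = contradiction refl t≢0

-- By minimality w̃ increases from position a + 1 on, while the full column c leaves a value ≤ c
-- at a position ≥ a + 1 + c; together these force w̃(a + 1) = 0.  But without a cross at (a, 0)
-- the 0 stays at a position ≤ a.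
topPipeDream-bottomRow : ∀ {a b D W c} → IsTopPipeDream (suc a) b D W → c < b →
  D a c ≡ true → D a 0 ≡ true
topPipeDream-bottomRow {a} {b} {D} {c = c} (_ , _ , (u , minimal , δ≗u) , closed) c<b Dac
  with D a 0 in corner
... | true  = refl
... | false =
  contradiction (perm-injective (proj₁ (proj₂ minimal)) (trans ux₀≡0 (sym u[1+a]≡0))) (<⇒≢ (s≤s x₀≤a))
  where
    pushed : Displaced c (suc a) (δ (suc a) b D)
    pushed = δ-column-displaced D c<b (suc a) (λ i i<1+a → northClosed-≤ closed (≤-pred i<1+a) Dac)

    zero-stays : ZeroWithin a (δ (suc a) b D)
    zero-stays = subst (ZeroWithin a) (sym (δ-suc a b D))
                       (rowWord-zeroWithin D a corner b _ (δ-zeroWithin b D a))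

    p : ℕ
    p = proj₁ pushed

    x₀ : ℕ
    x₀ = proj₁ zero-stays

    x₀≤a : x₀ ≤ a
    x₀≤a = proj₁ (proj₂ zero-stays)

    ux₀≡0 : u x₀ ≡ 0
    ux₀≡0 = trans (sym (δ≗u x₀)) (proj₂ (proj₂ zero-stays))

    d : ℕ
    d = p ∸ suc a

    1+a+d≡p : suc a + d ≡ p
    1+a+d≡p = m+[n∸m]≡n (≤-trans (m≤m+n (suc a) c) (proj₁ (proj₂ pushed)))

    c≤d : c ≤ d
    c≤d = +-cancelˡ-≤ (suc a) c d (subst (suc a + c ≤_) (sym 1+a+d≡p) (proj₁ (proj₂ pushed)))

    u[1+a]≡0 : u (suc a) ≡ 0
    u[1+a]≡0 = n≤0⇒n≡0 (+-cancelʳ-≤ d (u (suc a)) 0 (begin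
      u (suc a) + d    ≤⟨ increasing⇒+-≤ u (minCompletion-increasing minimal) d ⟩
      u (suc a + d)    ≡⟨ cong u 1+a+d≡p ⟩
      u p              ≡⟨ sym (δ≗u p) ⟩
      δ (suc a) b D p  ≤⟨ proj₂ (proj₂ pushed) ⟩
      c                ≤⟨ c≤d ⟩
      d                ∎))
      where open ≤-Reasoning

topPipeDream-corner : ∀ {a b D W i c} → IsTopPipeDream (suc a) b D W → c < b → D i c ≡ true →
  i ≡ a ⊎ c ≡ 0 → D 0 0 ≡ true
topPipeDream-corner top@(_ , _ , _ , closed) c<b Dic (inj₁ refl) =
  northClosed-≤ closed z≤n (topPipeDream-bottomRow top c<b Dic)
topPipeDream-corner (_ , _ , _ , closed) _ Dic (inj₂ refl) = northClosed-≤ closed z≤n Dic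

-- Blocks of P(P₁,…,Pₙ) and of Zelevinsky permutations

prefix-shift : ∀ s k → prefix s (suc k) ≡ s 0 + prefix (s ∘ suc) k
prefix-shift s zero    = +-comm 0 (s 0)
prefix-shift s (suc k) = trans (cong (_+ s (suc k)) (prefix-shift s k)) (+-assoc (s 0) _ _)

prefix-mono : ∀ s {k m} → k ≤ m → prefix s k ≤ prefix s m
prefix-mono s {m = zero}  z≤n = ≤-refl
prefix-mono s {k} {suc m} k≤1+m with m≤n⇒m<n∨m≡n k≤1+m
... | inj₂ refl   = ≤-refl
... | inj₁ k<1+m = ≤-trans (prefix-mono s (≤-pred k<1+m)) (m≤m+n (prefix s m) (s m))

rowBlk-prefix+ : ∀ n s k r → k ≤ n → r < s k → rowBlk n s (prefix s k + r) ≡ k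
rowBlk-prefix+ zero    s zero    r _ _ = refl
rowBlk-prefix+ (suc n) s zero    r _ r<s₀ rewrite T⇒≡true (<⇒<ᵇ r<s₀) = refl
rowBlk-prefix+ (suc n) s (suc k) r (s≤s k≤n) r<s
  rewrite prefix-shift s k | +-assoc (s 0) (prefix (s ∘ suc) k) r
        | ¬T⇒≡false (λ t → <⇒≱ (<ᵇ⇒< _ _ t) (m≤m+n (s 0) (prefix (s ∘ suc) k + r)))
        | m+n∸m≡n (s 0) (prefix (s ∘ suc) k + r)
  = cong suc (rowBlk-prefix+ n (s ∘ suc) k r k≤n r<s)

rowBlk-≤ : ∀ n s x → rowBlk n s x ≤ n
rowBlk-≤ zero    s x = z≤n
rowBlk-≤ (suc n) s x with x <ᵇ s 0
... | true  = z≤n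
... | false = s≤s (rowBlk-≤ n (s ∘ suc) (x ∸ s 0))

rowBlk≡0⇒< : ∀ n s x → rowBlk (suc n) s x ≡ 0 → x < s 0
rowBlk≡0⇒< n s x rowBlk≡0 with x <ᵇ s 0 | <ᵇ-reflects-< x (s 0)
... | true  | ofʸ x<s₀ = x<s₀
... | false | ofⁿ _    = contradiction rowBlk≡0 λ ()

colBlk≡0-mono : ∀ n s {y y′} → colBlk (suc n) s y ≡ 0 → y ≤ y′ → colBlk (suc n) s y′ ≡ 0
colBlk≡0-mono n s {y} {y′} colBlk≡0 y≤y′ =
  rowBlk-prefix+ (suc n) s 0 _ z≤n
    (≤-<-trans (∸-monoʳ-≤ (total (suc n) s) (s≤s y≤y′)) (rowBlk≡0⇒< n s _ colBlk≡0))

bigPD-superantidiagonal : ∀ n s Ps {x y} → x < total n s → y < total n s →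
  colBlk n s y ≡ suc (rowBlk n s x) →
  bigPD n s Ps x y ≡
    Ps (suc (rowBlk n s x)) (x ∸ prefix s (rowBlk n s x)) (y ∸ colStart n s (suc (rowBlk n s x)))
bigPD-superantidiagonal n s Ps {x} {y} x<N y<N colBlk≡
  rewrite T⇒≡true (<⇒<ᵇ x<N) | T⇒≡true (<⇒<ᵇ y<N) | colBlk≡
        | ¬T⇒≡false (λ t → <⇒≱ (≤-reflexive (+-comm 2 (rowBlk n s x))) (≤ᵇ⇒≤ _ _ t))
        | T⇒≡true (≡⇒≡ᵇ (rowBlk n s x) (rowBlk n s x) refl)
  = refl

summands-< : ∀ {m n o} → suc (suc (m + n)) ≡ o → m < o × n < o
summands-< {m} {n} refl = s≤s (m≤n⇒m≤1+n (m≤m+n m n)) , s≤s (m≤n⇒m≤1+n (m≤n+m n m))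

bigPD-blockCorner : ∀ n s Ps {j} → j < n →
  ∃₂ λ X Y → suc (suc (X + Y)) ≡ total n (plus1 s) ×
            bigPD n (plus1 s) Ps X Y ≡ Ps (suc j) (s j) (s (suc j))
bigPD-blockCorner n s Ps {j} j<n =
  X , Y , 2+X+Y≡N , trans (bigPD-superantidiagonal n s′ Ps X<N Y<N colBlk-Y≡) local-coordinates
  where
    s′ : ℕ → ℕ
    s′ = plus1 s

    N R X Y : ℕ
    N = total n s′
    R = N ∸ prefix s′ (suc (suc j))
    X = prefix s′ j + s j
    Y = R + s (suc j)

    N≡prefix+R : prefix s′ (suc (suc j)) + R ≡ N
    N≡prefix+R = m+[n∸m]≡n (prefix-mono s′ (s≤s j<n))

    2+X+Y≡N : suc (suc (X + Y)) ≡ N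
    2+X+Y≡N = trans (rearrange (prefix s′ j) (s j) (s (suc j)) R) N≡prefix+R
      where
        rearrange : ∀ p a b r → suc (suc ((p + a) + (r + b))) ≡ p + suc a + suc b + r
        rearrange = solve-∀

    X<N : X < N
    X<N = proj₁ (summands-< {X} 2+X+Y≡N)

    Y<N : Y < N
    Y<N = proj₂ (summands-< {X} 2+X+Y≡N)

    rowBlk-X : rowBlk n s′ X ≡ j
    rowBlk-X = rowBlk-prefix+ n s′ j (s j) (<⇒≤ j<n) ≤-refl

    N∸1+Y : N ∸ suc Y ≡ prefix s′ (suc j) + 0
    N∸1+Y = begin
      N ∸ suc Y                            ≡⟨ cong (_∸ suc Y) (sym N≡prefix+R) ⟩
      prefix s′ (suc (suc j)) + R ∸ suc Y  ≡⟨ cong (_∸ suc Y) (rearrange (prefix s′ (suc j)) _ R) ⟩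
      prefix s′ (suc j) + suc Y ∸ suc Y    ≡⟨ m+n∸n≡m (prefix s′ (suc j)) (suc Y) ⟩
      prefix s′ (suc j)                    ≡⟨ sym (+-identityʳ _) ⟩
      prefix s′ (suc j) + 0                ∎
      where
        open ≡-Reasoning
        rearrange : ∀ q b r → q + suc b + r ≡ q + suc (r + b)
        rearrange = solve-∀

    colBlk-Y≡ : colBlk n s′ Y ≡ suc (rowBlk n s′ X)
    colBlk-Y≡ = trans (cong (rowBlk n s′) N∸1+Y)
                      (trans (rowBlk-prefix+ n s′ (suc j) 0 j<n (s≤s z≤n)) (cong suc (sym rowBlk-X)))

    local-coordinates :
      Ps (suc (rowBlk n s′ X)) (X ∸ prefix s′ (rowBlk n s′ X)) (Y ∸ colStart n s′ (suc (rowBlk n s′ X)))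
        ≡ Ps (suc j) (s j) (s (suc j))
    local-coordinates rewrite rowBlk-X | m+n∸m≡n (prefix s′ j) (s j) | m+n∸m≡n R (s (suc j)) = refl

rank-corner-witness : ∀ {n s v} → 0 < rank n s v 0 n →
  ∃ λ x → x < total n s × rowBlk n s x ≡ n × colBlk n s (v x) ≡ 0
rank-corner-witness {n} {s} {v} rank>0 with count-witness (total n s) _ rank>0
... | x , x<N , in-corner = x , x<N , rowBlk-x , n≤0⇒n≡0 (≤ᵇ⇒≤ _ _ (proj₂ in-corner′))
  where
    in-corner′ : T (n ≤ᵇ rowBlk n s x) × T (colBlk n s (v x) ≤ᵇ 0)
    in-corner′ = Equivalence.to T-∧ in-corner

    rowBlk-x : rowBlk n s x ≡ n
    rowBlk-x = ≤-antisym (rowBlk-≤ n s x) (≤ᵇ⇒≤ _ _ (proj₁ in-corner′))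

-- The 1 in row m lies right of the 1 in the bottom-right block, hence in block column 0.
zelevinsky-lastRow-colBlk≡0 : ∀ {n s v m} → Zelevinsky (suc n) (plus1 s) v →
  0 < rank (suc n) (plus1 s) v 0 (suc n) → total (suc n) (plus1 s) ≡ suc m →
  colBlk (suc n) (plus1 s) (v m) ≡ 0
zelevinsky-lastRow-colBlk≡0 {n} {s} {v} {m} (_ , _ , rows-increasing , _) rank>0 N≡1+m
  with rank-corner-witness {v = v} rank>0
... | x , x<N , rowBlk-x , colBlk-vx = colBlk≡0-mono n (plus1 s) colBlk-vx vx≤vm
  where
    m<N : m < total (suc n) (plus1 s)
    m<N = subst (m <_) (sym N≡1+m) ≤-refl

    rowBlk-m : rowBlk (suc n) (plus1 s) m ≡ suc n
    rowBlk-m = subst (λ k → rowBlk (suc n) (plus1 s) k ≡ suc n)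
      (suc-injective (trans (sym (+-suc (prefix (plus1 s) (suc n)) (s (suc n)))) N≡1+m))
      (rowBlk-prefix+ (suc n) (plus1 s) (suc n) (s (suc n)) ≤-refl ≤-refl)

    vx≤vm : v x ≤ v m
    vx≤vm with m≤n⇒m<n∨m≡n (≤-pred (subst (x <_) N≡1+m x<N))
    ... | inj₁ x<m  = <⇒≤ (rows-increasing x m x<m m<N (trans rowBlk-x (sym rowBlk-m)))
    ... | inj₂ refl = ≤-refl

-- The 1 in column m also lies in block column 0, so the NW-to-SE order there puts it in row m.
zelevinsky-last-fixed : ∀ {n s v m} → Zelevinsky (suc n) (plus1 s) v → StrictlySurjective _≡_ v →
  0 < rank (suc n) (plus1 s) v 0 (suc n) → total (suc n) (plus1 s) ≡ suc m → v m ≡ m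
zelevinsky-last-fixed {n} {s} {v} {m} zelevinsky@((bounded , _ , fixed) , _ , _ , columns-increasing)
                      surjective rank>0 N≡1+m
  with surjective m
... | z , vz≡m = ≤-antisym (≤-pred (subst (v m <_) N≡1+m (bounded m m<N))) m≤vm
  where
    N : ℕ
    N = total (suc n) (plus1 s)

    m<N : m < N
    m<N = subst (m <_) (sym N≡1+m) ≤-refl

    z<N : z < N
    z<N with z <? N
    ... | yes z<N = z<N
    ... | no  z≮N =
      contradiction (trans (sym (fixed z (≮⇒≥ z≮N))) vz≡m) (>⇒≢ (<-≤-trans m<N (≮⇒≥ z≮N)))

    colBlk-vz≡colBlk-vm : colBlk (suc n) (plus1 s) (v z) ≡ colBlk (suc n) (plus1 s) (v m)
    colBlk-vz≡colBlk-vm = begin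
      colBlk (suc n) (plus1 s) (v z)        ≡⟨ cong (colBlk (suc n) (plus1 s)) vz≡m ⟩
      rowBlk (suc n) (plus1 s) (N ∸ suc m)  ≡⟨ cong (rowBlk (suc n) (plus1 s)) N∸1+m≡0 ⟩
      0                                     ≡⟨ sym (zelevinsky-lastRow-colBlk≡0 {n} {s} zelevinsky
                                                                                  rank>0 N≡1+m) ⟩
      colBlk (suc n) (plus1 s) (v m)        ∎
      where
        open ≡-Reasoning
        N∸1+m≡0 : N ∸ suc m ≡ 0
        N∸1+m≡0 = trans (cong (_∸ suc m) N≡1+m) (n∸n≡0 m)

    m≤vm : m ≤ v m
    m≤vm with z ≟ m
    ... | yes refl = ≤-reflexive (sym vz≡m)
    ... | no  z≢m  = <⇒≤ (subst (_< v m) vz≡m (columns-increasing z m z<m m<N colBlk-vz≡colBlk-vm))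
      where
        z<m : z < m
        z<m = ≤∧≢⇒< (≤-pred (subst (z <_) N≡1+m z<N)) z≢m

blockCorner-elbow : ∀ {n s v Ps j} → Zelevinsky (suc n) (plus1 s) v →
  0 < rank (suc n) (plus1 s) v 0 (suc n) →
  InPD (total (suc n) (plus1 s)) (total (suc n) (plus1 s)) (bigPD (suc n) (plus1 s) Ps) v →
  j < suc n → Ps (suc j) (s j) (s (suc j)) ≢ true
blockCorner-elbow {n} {s} {v} {Ps} zelevinsky rank>0 δ≗v j<n corner
  with bigPD-blockCorner (suc n) s Ps j<n
... | X , Y , 2+X+Y≡N , corner≡ =
  <-irrefl refl (δ-fixing⇒cross-below (suc (X + Y)) P δ-fixes (trans corner≡ corner)
                                     (proj₁ (summands-< {X} 2+X+Y≡N)) (proj₂ (summands-< {X} 2+X+Y≡N)))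
  where
    N : ℕ
    N = total (suc n) (plus1 s)

    P : PipeDream
    P = bigPD (suc n) (plus1 s) Ps

    v-surjective : StrictlySurjective _≡_ v
    v-surjective y = let x , δx≡y = δ-surjective N N P y in x , trans (sym (δ≗v x)) δx≡y

    δ-fixes : ∀ p → suc (X + Y) ≤ p → δ N N P p ≡ p
    δ-fixes p le = trans (δ≗v p)
      (perm-fixes-from (proj₁ zelevinsky) (sym 2+X+Y≡N)
         (zelevinsky-last-fixed {n} {s} zelevinsky v-surjective rank>0 (sym 2+X+Y≡N)) p le)

rot-cross : ∀ {a b P x y} → P x y ≡ true → x < a → y < b → rot a b P (a ∸ suc x) (b ∸ suc y) ≡ true
rot-cross {suc a} {suc b} {P} {x} {y} pxy (s≤s x≤a) (s≤s y≤b)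
  rewrite T⇒≡true (<⇒<ᵇ (s≤s (m∸n≤m a x))) | T⇒≡true (<⇒<ᵇ (s≤s (m∸n≤m b y)))
        | m∸[m∸n]≡n x≤a | m∸[m∸n]≡n y≤b
  = pxy

lemma4p1 : (n : ℕ) (s : ℕ → ℕ) (v v' : ℕ → ℕ) →
    Zelevinsky n s v →
    Zelevinsky n (plus1 s) v' →
    (∀ i j → i ≤ j → j ≤ n → rank n (plus1 s) v' i j ≡ suc (rank n s v i j)) →
    (Ps : ℕ → PipeDream) →
    (∀ j → 1 ≤ j → j ≤ n → Fits (suc (s (j ∸ 1))) (suc (s j)) (Ps j)) →
    InPD (total n (plus1 s)) (total n (plus1 s)) (bigPD n (plus1 s) Ps) v' →
    (∀ j → 1 ≤ j → j ≤ n →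
       Σ (ℕ → ℕ → Bool) (λ W → PartialPerm (suc (s (j ∸ 1))) (suc (s j)) W ×
         IsTopPipeDream (suc (s (j ∸ 1))) (suc (s j))
           (rot (suc (s (j ∸ 1))) (suc (s j)) (Ps j)) W)) →
    ∀ j → 1 ≤ j → j ≤ n → ∀ x y → Ps j x y ≡ true → (1 ≤ x) × (y < s j)
lemma4p1 zero    _ _ _  _ _        _     _  _    _   _    _       (s≤s _) ()
lemma4p1 (suc n) s v v′ _ zelevinsky′ ranks Ps fits δ≗v′ tops (suc j) 1≤j (s≤s j≤n) x y cross =
  top-row-empty , right-column-empty
  where
    D : PipeDream
    D = rot (suc (s j)) (suc (s (suc j))) (Ps (suc j))

    W : ℕ → ℕ → Bool
    W = proj₁ (tops (suc j) 1≤j (s≤s j≤n))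

    top : IsTopPipeDream (suc (s j)) (suc (s (suc j))) D W
    top = proj₂ (proj₂ (tops (suc j) 1≤j (s≤s j≤n)))

    x<a : x < suc (s j)
    x<a = proj₁ (fits (suc j) 1≤j (s≤s j≤n) x y cross)

    y<b : y < suc (s (suc j))
    y<b = proj₂ (fits (suc j) 1≤j (s≤s j≤n) x y cross)

    rotated-cross : D (s j ∸ x) (s (suc j) ∸ y) ≡ true
    rotated-cross = rot-cross {P = Ps (suc j)} cross x<a y<b

    rank>0 : 0 < rank (suc n) (plus1 s) v′ 0 (suc n)
    rank>0 = subst (0 <_) (sym (ranks 0 (suc n) z≤n ≤-refl)) z<s

    D₀₀-elbow : D 0 0 ≢ true
    D₀₀-elbow = blockCorner-elbow {Ps = Ps} zelevinsky′ rank>0 δ≗v′ (s≤s j≤n)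

    D₀₀-cross : s j ∸ x ≡ s j ⊎ s (suc j) ∸ y ≡ 0 → D 0 0 ≡ true
    D₀₀-cross = topPipeDream-corner top (s≤s (m∸n≤m (s (suc j)) y)) rotated-cross

    top-row-empty : 1 ≤ x
    top-row-empty = n≢0⇒n>0 λ x≡0 → D₀₀-elbow (D₀₀-cross (inj₁ (cong (s j ∸_) x≡0)))

    right-column-empty : y < s (suc j)
    right-column-empty = ≤∧≢⇒< (≤-pred y<b) λ y≡b-1 →
      D₀₀-elbow (D₀₀-cross (inj₂ (trans (cong (s (suc j) ∸_) y≡b-1) (n∸n≡0 (s (suc j))))))
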